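{- Let $m,n\geq 2$ with $m\equiv 2\pmod 3$, and let $k_1=\lfloor m/3\rfloor$, $k_2=\lfloor n/3\rfloor$. Then: (i) if $n=3k_2$, then $\gamma(\overrightarrow{C_m}\Box \overrightarrow{C_n})=n(k_1+1)$; (ii) if $n=3k_2+1$ and $2k_2\geq k_1$, then $\gamma(\overrightarrow{C_m}\Box \overrightarrow{C_n})=n(k_1+1)$; (iii) if $n=3k_2+1$ and $2k_2<k_1$, then $\gamma(\overrightarrow{C_m}\Box \overrightarrow{C_n})>n(k_1+1)$; (iv) if $n=3k_2+2$ and $n\geq m$, then $\gamma(\overrightarrow{C_m}\Box \overrightarrow{C_n})=n(k_1+1)$; (v) if $n=3k_2+2$ and $n\leq m$, then $\gamma(\overrightarrow{C_m}\Box \overrightarrow{C_n})=m(k_2+1)$.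
   Context: For a digraph $D$, a vertex $u$ dominates $v$ if $u=v$ or $uv$ is an arc; $\gamma(D)$ is the minimum size of a set of vertices dominating every vertex. The directed cycle $\overrightarrow{C_n}$ has vertex set $\{0,\dots,n-1\}$ (integers mod $n$) and arcs $x\to x+1\pmod n$. The Cartesian product $D_1\Box D_2$ has vertex set $V_1\times V_2$ and an arc $(x_1,x_2)\to(y_1,y_2)$ iff either $x_1\to y_1$ is an arc of $D_1$ and $x_2=y_2$, or $x_2\to y_2$ is an arc of $D_2$ and $x_1=y_1$. -}

module Defs where

open import Level using (0ℓ)
open import Data.Nat using (ℕ; zero; suc; _≤_; NonZero)
open import Data.Fin using (Fin; toℕ; fromℕ<)
open import Data.Product using (_×_; _,_; ∃; Σ)
open import Data.Sum using (_⊎_)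
open import Data.List using (List; length)
open import Data.List.Membership.Propositional using (_∈_)
open import Data.List.Relation.Unary.Unique.Propositional using (Unique)
open import Data.Nat.DivMod using (_%_)
open import Relation.Binary.PropositionalEquality using (_≡_)

record Digraph : Set₁ where
  field
    V   : Set
    Arc : V → V → Set
open Digraph public

Dominates : (D : Digraph) → V D → V D → Set
Dominates D u v = (u ≡ v) ⊎ Arc D u v

IsDominating : (D : Digraph) → List (V D) → Set
IsDominating D S = ∀ v → ∃ λ u → (u ∈ S) × Dominates D u v

IsDomNumber : (D : Digraph) → ℕ → Set
IsDomNumber D k =
  (Σ (List (V D)) λ S → Unique S × IsDominating D S × length S ≡ k)
  × (∀ (S : List (V D)) → Unique S → IsDominating D S → k ≤ length S)

DirCycle : (n : ℕ) → .{{NonZero n}} → Digraph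
DirCycle n = record
  { V = Fin n
  ; Arc = λ x y → toℕ y ≡ (suc (toℕ x)) % n
  }

_□_ : Digraph → Digraph → Digraph
D₁ □ D₂ = record
  { V = V D₁ × V D₂
  ; Arc = λ { (x₁ , x₂) (y₁ , y₂) → (Arc D₁ x₁ y₁ × x₂ ≡ y₂) ⊎ (Arc D₂ x₂ y₂ × x₁ ≡ y₁) }
  }

-- Let S dominate C_m □ C_n and let S_y be its vertices in row y (second
-- coordinate y). Row y is dominated only by S_y (each vertex dominates itself and its
-- right neighbour) and by S_(y-1) (each vertex dominates the vertex below it), so
-- m ≤ 2|S_y| + |S_(y-1)| (rowCover). A discharging argument around the cycle C_n
-- (telescope, transfer₂) turns these inequalities into |S| ≥ n(k + 1). Read along the
-- columns when n = 3k₂ + 1 the same argument (transfer₁) gives 2|S| ≥ m(2k₂ + 1), which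
-- exceeds 2n(k + 1) when 2k₂ < k; this is part (iii).
--
-- Give row y the k + 1 vertices at columns o_y, o_y + 3, …, o_y + 3k. Its
-- gaps o_y + 2 + 3i are covered from row y - 1 whenever o_(y-1) + 3e ≡ o_y + 2 (mod m)
-- for some e ∈ {0, 1} (Staircase). Offsets that fall by 2 for b steps and then rise by 1
-- (zigzag) always satisfy this between consecutive rows, and close up around C_n for a
-- suitable b in cases (i), (ii) and (iv); case (v) is (iv) with the factors swapped.
module Submission where

open import Defs
open import Data.Nat using (ℕ; zero; suc; _+_; _*_; _∸_; _≤_; _<_; _⊓_; NonZero; z≤n; s≤s)
open import Data.Nat.Properties hiding (_≟_)
open import Data.Nat.DivMod
open import Data.Nat.Divisibility using (_∣_; divides)
open import Data.Fin using (Fin; zero; suc; toℕ; fromℕ; fromℕ<; inject₁)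
open import Data.Fin.Properties using (_≟_; injective⇒≤; toℕ-injective; toℕ<n; toℕ-fromℕ; toℕ-fromℕ<; toℕ-inject₁; toℕ≤pred[n])
open import Data.Product using (_×_; _,_; ∃; Σ; proj₁; proj₂; swap)
open import Data.Sum using (inj₁; inj₂)
open import Data.Bool using (if_then_else_)
open import Function using (_∘_)
open import Data.List using (List; []; _∷_; length; map; filter; _++_; lookup; cartesianProduct; allFin)
open import Data.List.Properties using (length-map; length-++; length-tabulate)
open import Data.List.Membership.Propositional using (_∈_)
open import Data.List.Membership.Propositional.Properties using (∈-map⁺; ∈-filter⁺; ∈-++⁺ˡ; ∈-++⁺ʳ; ∈-cartesianProduct⁺; ∈-allFin)
import Data.List.Relation.Unary.Any as Any
open import Data.List.Relation.Unary.Any.Properties using (lookup-index)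
open import Data.List.Relation.Unary.Unique.Propositional using (Unique)
import Data.List.Relation.Unary.Unique.Propositional.Properties as Unique
open import Relation.Nullary using (Dec; yes; no; does)
open import Relation.Binary.PropositionalEquality
open import Data.Nat.Tactic.RingSolver using (solve-∀)
open import Algebra.Properties.CommutativeMonoid.Sum +-0-commutativeMonoid using (sum; sum-cong-≗; ∑-distrib-+; sum-init-last)

%-+-congʳ : ∀ M .{{_ : NonZero M}} {a b} c → a % M ≡ b % M → (a + c) % M ≡ (b + c) % M
%-+-congʳ M {a} {b} c a≡b = begin
  (a + c) % M         ≡⟨ %-distribˡ-+ a c M ⟩
  (a % M + c % M) % M ≡⟨ cong (λ r → (r + c % M) % M) a≡b ⟩
  (b % M + c % M) % M ≡⟨ sym (%-distribˡ-+ b c M) ⟩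
  (b + c) % M         ∎
  where open ≡-Reasoning

%-+-congˡ : ∀ M .{{_ : NonZero M}} {a b} c → a % M ≡ b % M → (c + a) % M ≡ (c + b) % M
%-+-congˡ M {a} {b} c a≡b =
  trans (cong (_% M) (+-comm c a)) (trans (%-+-congʳ M c a≡b) (cong (_% M) (+-comm b c)))

toℕ-mod : ∀ M .{{_ : NonZero M}} a → toℕ (a mod M) ≡ a % M
toℕ-mod M a = toℕ-fromℕ< (m%n<n a M)

neg : ∀ M .{{_ : NonZero M}} → ℕ → ℕ
neg M o = M ∸ o % M

M∣o+neg : ∀ M .{{_ : NonZero M}} o → M ∣ o + neg M o
M∣o+neg M o = divides (suc (o / M)) (begin
  o + (M ∸ o % M)                   ≡⟨ cong (_+ (M ∸ o % M)) (m≡m%n+[m/n]*n o M) ⟩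
  o % M + o / M * M + (M ∸ o % M)   ≡⟨ rearrange (o % M) (o / M * M) (M ∸ o % M) ⟩
  o / M * M + (o % M + (M ∸ o % M)) ≡⟨ cong (o / M * M +_) (m+[n∸m]≡n (m%n≤n o M)) ⟩
  o / M * M + M                     ≡⟨ +-comm (o / M * M) M ⟩
  suc (o / M) * M                   ∎)
  where
  open ≡-Reasoning
  rearrange : ∀ a b c → a + b + c ≡ b + (a + c)
  rearrange = solve-∀

%-neg : ∀ M .{{_ : NonZero M}} o a → (o + a + neg M o) % M ≡ a % M
%-neg M o a = trans (cong (_% M) (rearrange o a (neg M o))) (%-remove-+ʳ a (M∣o+neg M o))
  where
  rearrange : ∀ o a c → o + a + c ≡ a + (o + c)
  rearrange = solve-∀

%-+-cancelˡ : ∀ M .{{_ : NonZero M}} o {a b} → (o + a) % M ≡ (o + b) % M → a < M → b < M → a ≡ b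
%-+-cancelˡ M o {a} {b} eq a<M b<M = begin
  a                      ≡⟨ sym (m<n⇒m%n≡m a<M) ⟩
  a % M                  ≡⟨ sym (%-neg M o a) ⟩
  (o + a + neg M o) % M  ≡⟨ %-+-congʳ M (neg M o) eq ⟩
  (o + b + neg M o) % M  ≡⟨ %-neg M o b ⟩
  b % M                  ≡⟨ m<n⇒m%n≡m b<M ⟩
  b                      ∎
  where open ≡-Reasoning

%-+-solve : ∀ M .{{_ : NonZero M}} o {x} → x < M → ∃ λ d → d < M × (o + d) % M ≡ x
%-+-solve M o {x} x<M = (x + neg M o) % M , m%n<n _ M , (begin
  (o + (x + neg M o) % M) % M ≡⟨ %-+-congˡ M o (m%n%n≡m%n (x + neg M o) M) ⟩
  (o + (x + neg M o)) % M     ≡⟨ cong (_% M) (sym (+-assoc o x (neg M o))) ⟩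
  (o + x + neg M o) % M       ≡⟨ %-neg M o x ⟩
  x % M                       ≡⟨ m<n⇒m%n≡m x<M ⟩
  x                           ∎)
  where open ≡-Reasoning

succc : ∀ {m} .{{_ : NonZero m}} → Fin m → Fin m
succc {m} x = suc (toℕ x) mod m

arc⇒≡succc : ∀ {m} .{{_ : NonZero m}} {x' x : Fin m} → Arc (DirCycle m) x' x → x ≡ succc x'
arc⇒≡succc {m} {x'} arc = toℕ-injective (trans arc (sym (toℕ-mod m (suc (toℕ x')))))

predc : ∀ {n} → Fin (suc n) → Fin (suc n)
predc {n} zero = fromℕ n
predc (suc i) = inject₁ i

predc-arc : ∀ {n} (y : Fin (suc n)) → Arc (DirCycle (suc n)) (predc y) y
predc-arc {n} zero = sym (begin
  suc (toℕ (fromℕ n)) % suc n ≡⟨ cong (λ t → suc t % suc n) (toℕ-fromℕ n) ⟩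
  suc n % suc n               ≡⟨ n%n≡0 (suc n) ⟩
  0                           ∎)
  where open ≡-Reasoning
predc-arc {suc n} (suc i) = sym (begin
  suc (toℕ (inject₁ i)) % suc (suc n) ≡⟨ cong (λ t → suc t % suc (suc n)) (toℕ-inject₁ i) ⟩
  suc (toℕ i) % suc (suc n)           ≡⟨ m<n⇒m%n≡m (s≤s (toℕ<n i)) ⟩
  suc (toℕ i)                         ∎)
  where open ≡-Reasoning

arc⇒≡predc : ∀ {n} {y' y : Fin (suc n)} → Arc (DirCycle (suc n)) y' y → y' ≡ predc y
arc⇒≡predc {n} {y'} {y} arc with m≤n⇒m<n∨m≡n (toℕ≤pred[n] y')
... | inj₂ y'≡n = wrapAround y arc
  where
  wrapAround : ∀ y → toℕ y ≡ suc (toℕ y') % suc n → y' ≡ predc y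
  wrapAround zero _ = toℕ-injective (trans y'≡n (sym (toℕ-fromℕ n)))
  wrapAround (suc i) arc' with trans arc' (trans (cong (λ t → suc t % suc n) y'≡n) (n%n≡0 (suc n)))
  ... | ()
... | inj₁ y'<n = interior y (trans arc (m<n⇒m%n≡m (s≤s y'<n)))
  where
  interior : ∀ y → toℕ y ≡ suc (toℕ y') → y' ≡ predc y
  interior zero ()
  interior (suc i) eq = toℕ-injective (trans (sym (suc-injective eq)) (sym (toℕ-inject₁ i)))

sum-const : ∀ {n} c → sum {n} (λ _ → c) ≡ n * c
sum-const {zero} c = refl
sum-const {suc n} c = cong (c +_) (sum-const {n} c)

sum-mono-≤ : ∀ {n} {f g : Fin n → ℕ} → (∀ i → f i ≤ g i) → sum f ≤ sum g
sum-mono-≤ {zero} f≤g = z≤n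
sum-mono-≤ {suc n} f≤g = +-mono-≤ (f≤g zero) (sum-mono-≤ (λ i → f≤g (suc i)))

sum-predc : ∀ {n} (f : Fin (suc n) → ℕ) → sum (λ y → f (predc y)) ≡ sum f
sum-predc f = trans (+-comm (f (predc zero)) _) (sym (sum-init-last f))

-- Discharging along a cycle: if every vertex y, after receiving f (predc y) from its
-- predecessor and passing f y on, keeps at least c out of its weight g y, then the
-- total weight is at least c per vertex.
telescope : ∀ {n} c (f g : Fin (suc n) → ℕ) → (∀ y → c + f y ≤ g y + f (predc y)) → suc n * c ≤ sum g
telescope {n} c f g keeps = +-cancelʳ-≤ (sum f) (suc n * c) (sum g) (begin
  suc n * c + sum f                ≡⟨ cong (_+ sum f) (sum-const {suc n} c) ⟨
  sum {suc n} (λ _ → c) + sum f    ≡⟨ ∑-distrib-+ (λ _ → c) f ⟨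
  sum (λ y → c + f y)              ≤⟨ sum-mono-≤ keeps ⟩
  sum (λ y → g y + f (predc y))    ≡⟨ ∑-distrib-+ g (λ y → f (predc y)) ⟩
  sum g + sum (λ y → f (predc y))  ≡⟨ cong (sum g +_) (sum-predc f) ⟩
  sum g + sum f                    ∎)
  where open ≤-Reasoning

+-∸-≤ : ∀ x b t → x + b ∸ t ≤ x + (b ∸ t)
+-∸-≤ x b t = m≤n+o⇒m∸n≤o (x + b) t (begin
  x + b             ≤⟨ +-monoʳ-≤ x (m≤n+m∸n b t) ⟩
  x + (t + (b ∸ t)) ≡⟨ x+[t+d]≡t+[x+d] x t (b ∸ t) ⟩
  t + (x + (b ∸ t)) ∎)
  where
  open ≤-Reasoning
  x+[t+d]≡t+[x+d] : ∀ x t d → x + (t + d) ≡ t + (x + d)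
  x+[t+d]≡t+[x+d] = solve-∀

-- The local transfer inequalities: with a = |S_y| and b = |S_(y-1)| satisfying
-- m ≤ 2a + b, row y - 1 passes its excess over a threshold on to row y, in the shape
-- required by telescope. For m = 3k + 2 each row then keeps at least k + 1 vertices.
transfer₂ : ∀ k a b → 2 + k * 3 ≤ a + a + b → suc k + (a ∸ suc k) ≤ a + (b ∸ suc k)
transfer₂ k a b m≤2a+b with suc k ≤? a
... | yes k<a = begin
  suc k + (a ∸ suc k) ≡⟨ m+[n∸m]≡n k<a ⟩
  a                   ≤⟨ m≤m+n a (b ∸ suc k) ⟩
  a + (b ∸ suc k)     ∎
  where open ≤-Reasoning
... | no k≮a = begin
  suc k + (a ∸ suc k) ≡⟨ cong (suc k +_) (m≤n⇒m∸n≡0 (<⇒≤ a<1+k)) ⟩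
  suc k + 0           ≡⟨ +-identityʳ (suc k) ⟩
  suc k               ≤⟨ m+n≤o⇒m≤o∸n (suc k) 2k+2≤a+b ⟩
  a + b ∸ suc k       ≤⟨ +-∸-≤ a b (suc k) ⟩
  a + (b ∸ suc k)     ∎
  where
  open ≤-Reasoning
  a<1+k : a < suc k
  a<1+k = ≰⇒> k≮a
  identity₁ : ∀ k → suc k + suc k + k ≡ 2 + k * 3
  identity₁ = solve-∀
  identity₂ : ∀ a b → a + a + b ≡ a + b + a
  identity₂ = solve-∀
  2k+2≤a+b : suc k + suc k ≤ a + b
  2k+2≤a+b = +-cancelʳ-≤ a (suc k + suc k) (a + b) (begin
    suc k + suc k + a ≤⟨ +-monoʳ-≤ (suc k + suc k) (≤-pred a<1+k) ⟩
    suc k + suc k + k ≡⟨ identity₁ k ⟩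
    2 + k * 3         ≤⟨ m≤2a+b ⟩
    a + a + b         ≡⟨ identity₂ a b ⟩
    a + b + a         ∎)

-- For m = 3k + 1 each row keeps at least k + 1/2 vertices (counted twice).
transfer₁ : ∀ k a b → 1 + k * 3 ≤ a + a + b → 1 + k * 2 + (a ∸ k) ≤ a + a + (b ∸ k)
transfer₁ k a b m≤2a+b with k <? a
... | yes k<a = begin
  1 + k * 2 + (a ∸ k)   ≡⟨ identity k (a ∸ k) ⟩
  suc k + (k + (a ∸ k)) ≡⟨ cong (suc k +_) (m+[n∸m]≡n (<⇒≤ k<a)) ⟩
  suc k + a             ≤⟨ +-monoˡ-≤ a k<a ⟩
  a + a                 ≤⟨ m≤m+n (a + a) (b ∸ k) ⟩
  a + a + (b ∸ k)       ∎
  where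
  open ≤-Reasoning
  identity : ∀ k d → 1 + k * 2 + d ≡ suc k + (k + d)
  identity = solve-∀
... | no k≮a = begin
  1 + k * 2 + (a ∸ k) ≡⟨ cong (1 + k * 2 +_) (m≤n⇒m∸n≡0 (≮⇒≥ k≮a)) ⟩
  1 + k * 2 + 0       ≡⟨ +-identityʳ (1 + k * 2) ⟩
  1 + k * 2           ≤⟨ m+n≤o⇒m≤o∸n (1 + k * 2) (≤-trans (≤-reflexive (identity k)) m≤2a+b) ⟩
  a + a + b ∸ k       ≤⟨ +-∸-≤ (a + a) b k ⟩
  a + a + (b ∸ k)     ∎
  where
  open ≤-Reasoning
  identity : ∀ k → 1 + k * 2 + k ≡ 1 + k * 3
  identity = solve-∀

covering⇒≤length : ∀ {p} (L : List (Fin p)) → (∀ x → x ∈ L) → p ≤ length L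
covering⇒≤length L covers = injective⇒≤ {f = λ x → Any.index (covers x)} index-injective
  where
  index-injective : ∀ {x y} → Any.index (covers x) ≡ Any.index (covers y) → x ≡ y
  index-injective {x} {y} eq =
    trans (lookup-index (covers x)) (trans (cong (lookup L) eq) (sym (lookup-index (covers y))))

indicator : ∀ {A : Set} → Dec A → ℕ
indicator d = if does d then 1 else 0

sum-indicator : ∀ {n} (c : Fin n) → sum (λ y → indicator (c ≟ y)) ≡ 1
sum-indicator {suc n} zero = cong suc (trans (sum-const {n} 0) (*-zeroʳ n))
sum-indicator {suc n} (suc c) = sum-indicator c

fibre : ∀ {A : Set} {n} (π : A → Fin n) → Fin n → List A → List A
fibre π y = filter (λ u → π u ≟ y)

sum-fibre : ∀ {A : Set} {n} (π : A → Fin n) (S : List A) → sum (λ y → length (fibre π y S)) ≡ length S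
sum-fibre {n = n} π [] = trans (sum-const {n} 0) (*-zeroʳ n)
sum-fibre π (u ∷ S) = begin
  sum (λ y → length (fibre π y (u ∷ S)))                          ≡⟨ sum-cong-≗ length-fibre-∷ ⟩
  sum (λ y → indicator (π u ≟ y) + length (fibre π y S))          ≡⟨ ∑-distrib-+ (λ y → indicator (π u ≟ y)) (λ y → length (fibre π y S)) ⟩
  sum (λ y → indicator (π u ≟ y)) + sum (λ y → length (fibre π y S)) ≡⟨ cong₂ _+_ (sum-indicator (π u)) (sum-fibre π S) ⟩
  suc (length S)                                                  ∎
  where
  open ≡-Reasoning
  length-fibre-∷ : ∀ y → length (fibre π y (u ∷ S)) ≡ indicator (π u ≟ y) + length (fibre π y S)
  length-fibre-∷ y with π u ≟ y
  ... | yes _ = refl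
  ... | no _ = refl

-- The torus C_(p+1) □ C_(q+1), whose vertices are pairs (column, row).
Torus : ℕ → ℕ → Digraph
Torus p q = DirCycle (suc p) □ DirCycle (suc q)

rowSize : ∀ {p q} → List (Fin (suc p) × Fin (suc q)) → Fin (suc q) → ℕ
rowSize S y = length (fibre proj₂ y S)

-- Row y is dominated only from row y (a vertex and its right neighbour) and from
-- row y - 1 (the vertex above), hence p + 1 ≤ 2 |S ∩ row y| + |S ∩ row (y - 1)|.
rowCover : ∀ {p q} S → IsDominating (Torus p q) S → ∀ y →
  suc p ≤ rowSize S y + rowSize S y + rowSize S (predc y)
rowCover {p} S dom y = ≤-trans (covering⇒≤length L covers) (≤-reflexive length-L)
  where
  here = fibre proj₂ y S
  below = fibre proj₂ (predc y) S
  L : List (Fin (suc p))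
  L = map proj₁ here ++ (map (succc ∘ proj₁) here ++ map proj₁ below)
  length-L : length L ≡ rowSize S y + rowSize S y + rowSize S (predc y)
  length-L = begin
    length L ≡⟨ length-++ (map proj₁ here) ⟩
    length (map proj₁ here) + length (map (succc ∘ proj₁) here ++ map proj₁ below)
      ≡⟨ cong₂ _+_ (length-map proj₁ here) (length-++ (map (succc ∘ proj₁) here)) ⟩
    length here + (length (map (succc ∘ proj₁) here) + length (map proj₁ below))
      ≡⟨ cong (λ t → length here + t) (cong₂ _+_ (length-map (succc ∘ proj₁) here) (length-map proj₁ below)) ⟩
    length here + (length here + length below) ≡⟨ sym (+-assoc (length here) _ _) ⟩
    length here + length here + length below ∎
    where open ≡-Reasoning
  covers : ∀ x → x ∈ L
  covers x with dom (x , y)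
  ... | (x' , _) , u∈S , inj₁ refl =
    ∈-++⁺ˡ (∈-map⁺ proj₁ (∈-filter⁺ (λ u → proj₂ u ≟ y) u∈S refl))
  ... | (x' , _) , u∈S , inj₂ (inj₁ (arc , refl)) =
    ∈-++⁺ʳ (map proj₁ here) (∈-++⁺ˡ (subst (_∈ map (succc ∘ proj₁) here) (sym (arc⇒≡succc arc))
      (∈-map⁺ (succc ∘ proj₁) (∈-filter⁺ (λ u → proj₂ u ≟ y) u∈S refl))))
  ... | (_ , y') , u∈S , inj₂ (inj₂ (arc , refl)) =
    ∈-++⁺ʳ (map proj₁ here) (∈-++⁺ʳ (map (succc ∘ proj₁) here)
      (∈-map⁺ proj₁ (∈-filter⁺ (λ u → proj₂ u ≟ predc y) u∈S (arc⇒≡predc arc))))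

lowerBound₂ : ∀ p q k → suc p ≡ 2 + k * 3 → ∀ S → IsDominating (Torus p q) S → suc q * suc k ≤ length S
lowerBound₂ p q k m≡3k+2 S dom = begin
  suc q * suc k ≤⟨ telescope (suc k) (λ y → rowSize S y ∸ suc k) (rowSize S) transfer ⟩
  sum (rowSize S) ≡⟨ sum-fibre proj₂ S ⟩
  length S ∎
  where
  open ≤-Reasoning
  transfer : ∀ y → suc k + (rowSize S y ∸ suc k) ≤ rowSize S y + (rowSize S (predc y) ∸ suc k)
  transfer y = transfer₂ k (rowSize S y) (rowSize S (predc y))
    (subst (_≤ rowSize S y + rowSize S y + rowSize S (predc y)) m≡3k+2 (rowCover S dom y))

lowerBound₁ : ∀ p q k → suc p ≡ 1 + k * 3 → ∀ S → IsDominating (Torus p q) S →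
  suc q * (1 + k * 2) ≤ length S + length S
lowerBound₁ p q k m≡3k+1 S dom = begin
  suc q * (1 + k * 2) ≤⟨ telescope (1 + k * 2) (λ y → rowSize S y ∸ k) (λ y → rowSize S y + rowSize S y) transfer ⟩
  sum (λ y → rowSize S y + rowSize S y) ≡⟨ ∑-distrib-+ (rowSize S) (rowSize S) ⟩
  sum (rowSize S) + sum (rowSize S) ≡⟨ cong₂ _+_ (sum-fibre proj₂ S) (sum-fibre proj₂ S) ⟩
  length S + length S ∎
  where
  open ≤-Reasoning
  transfer : ∀ y → 1 + k * 2 + (rowSize S y ∸ k) ≤ rowSize S y + rowSize S y + (rowSize S (predc y) ∸ k)
  transfer y = transfer₁ k (rowSize S y) (rowSize S (predc y))
    (subst (_≤ rowSize S y + rowSize S y + rowSize S (predc y)) m≡3k+1 (rowCover S dom y))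

swap-dominates : ∀ {D₁ D₂ : Digraph} (u v : V D₁ × V D₂) →
  Dominates (D₁ □ D₂) u v → Dominates (D₂ □ D₁) (swap u) (swap v)
swap-dominates u v (inj₁ refl) = inj₁ refl
swap-dominates (_ , _) (_ , _) (inj₂ (inj₁ arc)) = inj₂ (inj₂ arc)
swap-dominates (_ , _) (_ , _) (inj₂ (inj₂ arc)) = inj₂ (inj₁ arc)

swap-dominating : ∀ {D₁ D₂ : Digraph} S → IsDominating (D₁ □ D₂) S → IsDominating (D₂ □ D₁) (map swap S)
swap-dominating {D₁} {D₂} S dom (b , a) with dom (a , b)
... | u , u∈S , u↦v = swap u , ∈-map⁺ swap u∈S , swap-dominates {D₁} {D₂} u (a , b) u↦v

swap-unique : ∀ {A B : Set} (S : List (A × B)) → Unique S → Unique (map swap S)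
swap-unique S = Unique.map⁺ swap-injective
  where
  swap-injective : ∀ {x y} → swap x ≡ swap y → x ≡ y
  swap-injective {_ , _} {_ , _} refl = refl

swap-domNumber : ∀ {D₁ D₂ : Digraph} k → IsDomNumber (D₁ □ D₂) k → IsDomNumber (D₂ □ D₁) k
swap-domNumber {D₁} {D₂} k ((S , unique , dom , |S|≡k) , minimal) =
  (map swap S , swap-unique S unique , swap-dominating {D₁} {D₂} S dom , trans (length-map swap S) |S|≡k) ,
  λ S' unique' dom' → begin
    k                    ≤⟨ minimal (map swap S') (swap-unique S' unique') (swap-dominating {D₂} {D₁} S' dom') ⟩
    length (map swap S') ≡⟨ length-map swap S' ⟩
    length S'            ∎
  where open ≤-Reasoning

length-cartesianProduct : ∀ {A B : Set} (xs : List A) (ys : List B) →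
  length (cartesianProduct xs ys) ≡ length xs * length ys
length-cartesianProduct [] ys = refl
length-cartesianProduct (x ∷ xs) ys = begin
  length (map (x ,_) ys ++ cartesianProduct xs ys)       ≡⟨ length-++ (map (x ,_) ys) ⟩
  length (map (x ,_) ys) + length (cartesianProduct xs ys) ≡⟨ cong₂ _+_ (length-map (x ,_) ys) (length-cartesianProduct xs ys) ⟩
  length ys + length xs * length ys                      ∎
  where open ≡-Reasoning

-- Rows with column offsets a (row y - 1) and a' (row y) are compatible modulo
-- m = 3k + 2 if a + 3e ≡ a' + 2 (mod m) for some e ∈ {0, 1}: then row y - 1 has a
-- staircase vertex directly above each gap a' + 2 + 3i of row y.
Compatible : ∀ M .{{_ : NonZero M}} → ℕ → ℕ → Set
Compatible M a a' = ∃ λ e → e ≤ 1 × (a + e * 3) % M ≡ (a' + 2) % M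

module Staircase (p q k : ℕ) (m≡3k+2 : suc p ≡ 2 + k * 3) (o : Fin (suc q) → ℕ)
                 (compatible : ∀ y → Compatible (suc p) (o (predc y)) (o y)) where

  M : ℕ
  M = suc p

  place : Fin (suc q) × Fin (suc k) → Fin M × Fin (suc q)
  place (y , i) = (o y + toℕ i * 3) mod M , y

  staircase : List (Fin M × Fin (suc q))
  staircase = map place (cartesianProduct (allFin (suc q)) (allFin (suc k)))

  length-staircase : length staircase ≡ suc q * suc k
  length-staircase = begin
    length staircase ≡⟨ length-map place (cartesianProduct (allFin (suc q)) (allFin (suc k))) ⟩
    length (cartesianProduct (allFin (suc q)) (allFin (suc k)))
      ≡⟨ length-cartesianProduct (allFin (suc q)) (allFin (suc k)) ⟩
    length (allFin (suc q)) * length (allFin (suc k))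
      ≡⟨ cong₂ _*_ (length-tabulate {n = suc q} (λ y → y)) (length-tabulate {n = suc k} (λ i → i)) ⟩
    suc q * suc k ∎
    where open ≡-Reasoning

  3i<M : ∀ {i} → i ≤ k → i * 3 < M
  3i<M {i} i≤k = begin-strict
    i * 3     ≤⟨ *-monoˡ-≤ 3 i≤k ⟩
    k * 3     <⟨ m<n+m (k * 3) {2} (s≤s z≤n) ⟩
    2 + k * 3 ≡⟨ sym m≡3k+2 ⟩
    M         ∎
    where open ≤-Reasoning

  index≤k : ∀ r i → r + i * 3 < M → i ≤ k
  index≤k r i bound = ≤-pred (*-cancelʳ-< 3 i (suc k) (begin-strict
    i * 3     ≤⟨ m≤n+m (i * 3) r ⟩
    r + i * 3 <⟨ bound ⟩
    M         ≡⟨ m≡3k+2 ⟩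
    2 + k * 3 <⟨ n<1+n (2 + k * 3) ⟩
    suc k * 3 ∎))
    where open ≤-Reasoning

  gap<k : ∀ i → 2 + i * 3 < M → i < k
  gap<k i bound = *-cancelʳ-< 3 i k (+-cancelˡ-< 2 (i * 3) (k * 3) (subst (2 + i * 3 <_) m≡3k+2 bound))

  place-injective : ∀ {u v} → place u ≡ place v → u ≡ v
  place-injective {y , i} {y' , i'} eq with cong proj₂ eq
  ... | refl = cong (y ,_) (toℕ-injective (*-cancelʳ-≡ (toℕ i) (toℕ i') 3
        (%-+-cancelˡ M (o y) same-column (3i<M (≤-pred (toℕ<n i))) (3i<M (≤-pred (toℕ<n i'))))))
    where
    same-column : (o y + toℕ i * 3) % M ≡ (o y + toℕ i' * 3) % M
    same-column = trans (sym (toℕ-mod M (o y + toℕ i * 3)))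
      (trans (cong (toℕ ∘ proj₁) eq) (toℕ-mod M (o y + toℕ i' * 3)))

  staircase-unique : Unique staircase
  staircase-unique = Unique.map⁺ place-injective
    (Unique.cartesianProduct⁺ (Unique.allFin⁺ (suc q)) (Unique.allFin⁺ (suc k)))

  pick : ∀ y j → j ≤ k → Σ (Fin M) λ x → (x , y) ∈ staircase × toℕ x ≡ (o y + j * 3) % M
  pick y j j≤k = proj₁ (place (y , i)) ,
    ∈-map⁺ place (∈-cartesianProduct⁺ (∈-allFin y) (∈-allFin i)) ,
    trans (toℕ-mod M (o y + toℕ i * 3)) (cong (λ t → (o y + t * 3) % M) (toℕ-fromℕ< (s≤s j≤k)))
    where
    i : Fin (suc k)
    i = fromℕ< (s≤s j≤k)

  Dominated : Fin M → Fin (suc q) → Set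
  Dominated x y = ∃ λ u → u ∈ staircase × Dominates (Torus p q) u (x , y)

  on-staircase : ∀ x y i → i ≤ k → (o y + i * 3) % M ≡ toℕ x → Dominated x y
  on-staircase x y i i≤k at-x with pick y i i≤k
  ... | x' , x'∈ , x'-at = (x' , y) , x'∈ , inj₁ (cong (_, y) (toℕ-injective (trans x'-at at-x)))

  right-of-staircase : ∀ x y i → i ≤ k → (o y + (1 + i * 3)) % M ≡ toℕ x → Dominated x y
  right-of-staircase x y i i≤k at-x with pick y i i≤k
  ... | x' , x'∈ , x'-at = (x' , y) , x'∈ , inj₂ (inj₁ (arc , refl))
    where
    arc : toℕ x ≡ suc (toℕ x') % M
    arc = begin
      toℕ x                       ≡⟨ sym at-x ⟩
      (o y + (1 + i * 3)) % M     ≡⟨ cong (_% M) (+-suc (o y) (i * 3)) ⟩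
      (1 + (o y + i * 3)) % M     ≡⟨ sym (%-+-congˡ M 1 (m%n%n≡m%n (o y + i * 3) M)) ⟩
      (1 + (o y + i * 3) % M) % M ≡⟨ cong (λ t → suc t % M) (sym x'-at) ⟩
      suc (toℕ x') % M            ∎
      where open ≡-Reasoning

  -- A gap at column o y + 2 + 3i (i < k) is dominated from the previous row: by
  -- compatibility that row has its vertex with index i + e in the same column.
  below-staircase : ∀ x y i → i < k → (o y + (2 + i * 3)) % M ≡ toℕ x → Dominated x y
  below-staircase x y i i<k at-x with compatible y
  ... | e , e≤1 , shift with pick (predc y) (i + e) (≤-trans (+-monoʳ-≤ i e≤1) (≤-trans (≤-reflexive (+-comm i 1)) i<k))
  ... | x' , x'∈ , x'-at = (x' , predc y) , x'∈ , inj₂ (inj₂ (predc-arc y , toℕ-injective column))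
    where
    o' = o (predc y)
    rearrange : ∀ a i e → a + (i + e) * 3 ≡ a + e * 3 + i * 3
    rearrange = solve-∀
    column : toℕ x' ≡ toℕ x
    column = begin
      toℕ x'                   ≡⟨ x'-at ⟩
      (o' + (i + e) * 3) % M   ≡⟨ cong (_% M) (rearrange o' i e) ⟩
      (o' + e * 3 + i * 3) % M ≡⟨ %-+-congʳ M {o' + e * 3} {o y + 2} (i * 3) shift ⟩
      (o y + 2 + i * 3) % M    ≡⟨ cong (_% M) (+-assoc (o y) 2 (i * 3)) ⟩
      (o y + (2 + i * 3)) % M  ≡⟨ at-x ⟩
      toℕ x                    ∎
      where open ≡-Reasoning

  -- Every column is o y + r + 3i with r < 3 and r + 3i < m; the three residues r are
  -- handled by the three lemmas above.
  dominate : ∀ x y r i → r < 3 → r + i * 3 < M → (o y + (r + i * 3)) % M ≡ toℕ x → Dominated x y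
  dominate x y 0 i _ bound = on-staircase x y i (index≤k 0 i bound)
  dominate x y 1 i _ bound = right-of-staircase x y i (index≤k 1 i bound)
  dominate x y 2 i _ bound = below-staircase x y i (gap<k i bound)
  dominate x y (suc (suc (suc r))) i (s≤s (s≤s (s≤s ()))) bound

  staircase-dominating : IsDominating (Torus p q) staircase
  staircase-dominating (x , y) with %-+-solve M (o y) (toℕ<n x)
  ... | d , d<M , at-x = dominate x y (d % 3) (d / 3) (m%n<n d 3)
    (subst (_< M) d≡r+3i d<M) (subst (λ t → (o y + t) % M ≡ toℕ x) d≡r+3i at-x)
    where
    d≡r+3i : d ≡ d % 3 + d / 3 * 3
    d≡r+3i = m≡m%n+[m/n]*n d 3

  domNumber : IsDomNumber (Torus p q) (suc q * suc k)
  domNumber = (staircase , staircase-unique , staircase-dominating , length-staircase) ,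
    λ S _ dom → lowerBound₂ p q k m≡3k+2 S dom

-- The zigzag offsets: from row t to row t + 1 the offset falls by 2 modulo
-- m = 3k + 2 (that is, rises by 6k + 2) during the first b steps and rises by 1
-- afterwards.
zigzag : (k b t : ℕ) → ℕ
zigzag k b t = t + (1 + k * 6) * (t ⊓ b)

zigzag-compatible : ∀ p k b t → suc p ≡ 2 + k * 3 → Compatible (suc p) (zigzag k b t) (zigzag k b (suc t))
zigzag-compatible p k b t m≡3k+2 with suc t ≤? b
... | yes t<b = 0 , z≤n , (begin
  (zigzag k b t + 0) % suc p         ≡⟨ cong (_% suc p) (+-identityʳ (zigzag k b t)) ⟩
  zigzag k b t % suc p               ≡⟨ sym ([m+kn]%n≡m%n (zigzag k b t) 2 (suc p)) ⟩
  (zigzag k b t + 2 * suc p) % suc p ≡⟨ cong (_% suc p) (sym falls) ⟩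
  (zigzag k b (suc t) + 2) % suc p   ∎)
  where
  open ≡-Reasoning
  identity : ∀ k t → suc t + (1 + k * 6) * suc t + 2 ≡ t + (1 + k * 6) * t + 2 * (2 + k * 3)
  identity = solve-∀
  falls : zigzag k b (suc t) + 2 ≡ zigzag k b t + 2 * suc p
  falls = begin
    suc t + (1 + k * 6) * (suc t ⊓ b) + 2 ≡⟨ cong (λ s → suc t + (1 + k * 6) * s + 2) (m≤n⇒m⊓n≡m t<b) ⟩
    suc t + (1 + k * 6) * suc t + 2       ≡⟨ identity k t ⟩
    t + (1 + k * 6) * t + 2 * (2 + k * 3) ≡⟨ cong₂ (λ s m → t + (1 + k * 6) * s + 2 * m) (sym (m≤n⇒m⊓n≡m (<⇒≤ t<b))) (sym m≡3k+2) ⟩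
    t + (1 + k * 6) * (t ⊓ b) + 2 * suc p ∎
... | no t≮b = 1 , ≤-refl , cong (_% suc p) rises
  where
  open ≡-Reasoning
  b≤t : b ≤ t
  b≤t = ≤-pred (≰⇒> t≮b)
  identity : ∀ t c → t + c + 3 ≡ suc t + c + 2
  identity = solve-∀
  rises : zigzag k b t + 3 ≡ zigzag k b (suc t) + 2
  rises = begin
    t + (1 + k * 6) * (t ⊓ b) + 3       ≡⟨ cong (λ s → t + (1 + k * 6) * s + 3) (m≥n⇒m⊓n≡n b≤t) ⟩
    t + (1 + k * 6) * b + 3             ≡⟨ identity t ((1 + k * 6) * b) ⟩
    suc t + (1 + k * 6) * b + 2         ≡⟨ cong (λ s → suc t + (1 + k * 6) * s + 2) (sym (m≥n⇒m⊓n≡n (≤-trans b≤t (n≤1+n t)))) ⟩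
    suc t + (1 + k * 6) * (suc t ⊓ b) + 2 ∎

zigzag-closes : ∀ p q k b e w → b ≤ q → e ≤ 1 → q + (1 + k * 6) * b + e * 3 ≡ 2 + w * suc p →
  Compatible (suc p) (zigzag k b q) (zigzag k b 0)
zigzag-closes p q k b e w b≤q e≤1 closes = e , e≤1 , (begin
  (q + (1 + k * 6) * (q ⊓ b) + e * 3) % suc p ≡⟨ cong (λ s → (q + (1 + k * 6) * s + e * 3) % suc p) (m≥n⇒m⊓n≡n b≤q) ⟩
  (q + (1 + k * 6) * b + e * 3) % suc p       ≡⟨ cong (_% suc p) closes ⟩
  (2 + w * suc p) % suc p                     ≡⟨ [m+kn]%n≡m%n 2 w (suc p) ⟩
  2 % suc p                                   ≡⟨ cong (λ s → (s + 2) % suc p) (sym (*-zeroʳ (1 + k * 6))) ⟩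
  ((1 + k * 6) * 0 + 2) % suc p               ∎)
  where open ≡-Reasoning

zigzag-domNumber : ∀ p q k b e w → suc p ≡ 2 + k * 3 → b ≤ q → e ≤ 1 →
  q + (1 + k * 6) * b + e * 3 ≡ 2 + w * suc p → IsDomNumber (Torus p q) (suc q * suc k)
zigzag-domNumber p q k b e w m≡3k+2 b≤q e≤1 closes =
  Staircase.domNumber p q k m≡3k+2 (zigzag k b ∘ toℕ) compatible
  where
  compatible : ∀ y → Compatible (suc p) (zigzag k b (toℕ (predc y))) (zigzag k b (toℕ y))
  compatible zero = subst (λ t → Compatible (suc p) (zigzag k b t) (zigzag k b 0)) (sym (toℕ-fromℕ q))
    (zigzag-closes p q k b e w b≤q e≤1 closes)
  compatible (suc i) = subst (λ t → Compatible (suc p) (zigzag k b t) (zigzag k b (suc (toℕ i)))) (sym (toℕ-inject₁ i))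
    (zigzag-compatible p k b (toℕ i) m≡3k+2)

-- Upper bounds for m = 3k + 2 and n = 3k₂ + r, in the cases where n(k + 1) is
-- attained. For n = 3k₂: zigzag with b = k₂ falling steps and a final rising step.
upperBound₀ : ∀ p q k k₂ → suc p ≡ 2 + k * 3 → suc q ≡ k₂ * 3 → IsDomNumber (Torus p q) (suc q * suc k)
upperBound₀ p q k zero _ ()
upperBound₀ p q k (suc j) refl refl = zigzag-domNumber p q k (suc j) 1 (suc j * 2) refl b≤q ≤-refl (closes k j)
  where
  b≤q : suc j ≤ 2 + j * 3
  b≤q = s≤s (≤-trans (m≤m*n j 3) (n≤1+n (j * 3)))
  closes : ∀ k j → 2 + j * 3 + (1 + k * 6) * suc j + 1 * 3 ≡ 2 + suc j * 2 * (2 + k * 3)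
  closes = solve-∀

-- n = 3k₂ + 1 ≥ 2 with k ≤ 2k₂: zigzag with b = k + k₂ falling steps and a final falling step.
upperBound₁ : ∀ p q k k₂ → 1 ≤ q → suc p ≡ 2 + k * 3 → suc q ≡ 1 + k₂ * 3 → k ≤ 2 * k₂ →
  IsDomNumber (Torus p q) (suc q * suc k)
upperBound₁ p q k zero () _ refl _
upperBound₁ p q k (suc j) _ refl refl k≤2k₂ = zigzag-domNumber p q k (k + suc j) 0 (k * 2 + j * 2 + 1) refl b≤q z≤n (closes k j)
  where
  identity : ∀ j → 2 * suc j + suc j ≡ 3 + j * 3
  identity = solve-∀
  b≤q : k + suc j ≤ 3 + j * 3
  b≤q = ≤-trans (+-monoˡ-≤ (suc j) k≤2k₂) (≤-reflexive (identity j))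
  closes : ∀ k j → 3 + j * 3 + (1 + k * 6) * (k + suc j) + 0 * 3 ≡ 2 + (k * 2 + j * 2 + 1) * (2 + k * 3)
  closes = solve-∀

-- n = 3k₂ + 2 with k ≤ k₂: zigzag with b = k₂ - k falling steps and a final rising step.
upperBound₂ : ∀ p q k k₂ → suc p ≡ 2 + k * 3 → suc q ≡ 2 + k₂ * 3 → k ≤ k₂ → IsDomNumber (Torus p q) (suc q * suc k)
upperBound₂ p q k k₂ refl refl k≤k₂ with m≤n⇒∃[o]m+o≡n k≤k₂
... | d , refl = zigzag-domNumber p q k d 1 (d * 2 + 1) refl b≤q ≤-refl (closes k d)
  where
  b≤q : d ≤ 1 + (k + d) * 3
  b≤q = ≤-trans (m≤n+m d k) (≤-trans (m≤m*n (k + d) 3) (n≤1+n ((k + d) * 3)))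
  closes : ∀ k d → 1 + (k + d) * 3 + (1 + k * 6) * d + 1 * 3 ≡ 2 + (d * 2 + 1) * (2 + k * 3)
  closes = solve-∀

-- n = 3k₂ + 1 with 2k₂ < k: counting the rows of C_n □ C_m (the columns of
-- C_m □ C_n) gives 2|S| ≥ m(2k₂ + 1), and m(2k₂ + 1) exceeds 2n(k + 1).
excess : ∀ p q k k₂ → suc p ≡ 2 + k * 3 → suc q ≡ 1 + k₂ * 3 → 2 * k₂ < k →
  suc q * suc k + suc q * suc k < suc p * (1 + k₂ * 2)
excess p q k k₂ refl refl 2k₂<k with m≤n⇒∃[o]m+o≡n 2k₂<k
... | t , refl = ≤-trans (m≤m+n _ t) (≤-reflexive (identity k₂ t))
  where
  identity : ∀ k₂ t → let k = suc (2 * k₂ + t) in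
    suc ((1 + k₂ * 3) * suc k + (1 + k₂ * 3) * suc k) + t ≡ (2 + k * 3) * (1 + k₂ * 2)
  identity = solve-∀

strictBound₁ : ∀ p q k k₂ → suc p ≡ 2 + k * 3 → suc q ≡ 1 + k₂ * 3 → 2 * k₂ < k →
  ∀ g → IsDomNumber (Torus p q) g → suc q * suc k < g
strictBound₁ p q k k₂ m≡3k+2 n≡3k₂+1 2k₂<k g ((S , _ , dom , |S|≡g) , _) =
  ≰⇒> (λ g≤X → <⇒≱ 2X<2g (+-mono-≤ g≤X g≤X))
  where
  columns : suc p * (1 + k₂ * 2) ≤ g + g
  columns = subst (λ s → suc p * (1 + k₂ * 2) ≤ s + s) (trans (length-map swap S) |S|≡g)
    (lowerBound₁ q p k₂ n≡3k₂+1 (map swap S) (swap-dominating {DirCycle (suc p)} {DirCycle (suc q)} S dom))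
  2X<2g : suc q * suc k + suc q * suc k < g + g
  2X<2g = <-≤-trans (excess p q k k₂ m≡3k+2 n≡3k₂+1 2k₂<k) columns

residue-form : ∀ {x} a r → x ≡ 3 * a + r → x ≡ r + a * 3
residue-form a r x≡3a+r = trans x≡3a+r (trans (+-comm (3 * a) r) (cong (r +_) (*-comm 3 a)))

quotient-mono : ∀ {x y a b} → x ≡ 2 + a * 3 → y ≡ 2 + b * 3 → x ≤ y → a ≤ b
quotient-mono refl refl x≤y = *-cancelʳ-≤ _ _ 3 (+-cancelˡ-≤ 2 _ _ x≤y)

mainTheorem5 : (m n : ℕ) → .{{_ : NonZero m}} → .{{_ : NonZero n}} → 2 ≤ m → 2 ≤ n → m % 3 ≡ 2 →
    ((n ≡ 3 * (n / 3)) → IsDomNumber (DirCycle m □ DirCycle n) (n * (m / 3 + 1)))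
    × ((n ≡ 3 * (n / 3) + 1) → m / 3 ≤ 2 * (n / 3) → IsDomNumber (DirCycle m □ DirCycle n) (n * (m / 3 + 1)))
    × ((n ≡ 3 * (n / 3) + 1) → 2 * (n / 3) < m / 3 → ∀ g → IsDomNumber (DirCycle m □ DirCycle n) g → n * (m / 3 + 1) < g)
    × ((n ≡ 3 * (n / 3) + 2) → m ≤ n → IsDomNumber (DirCycle m □ DirCycle n) (n * (m / 3 + 1)))
    × ((n ≡ 3 * (n / 3) + 2) → n ≤ m → IsDomNumber (DirCycle m □ DirCycle n) (m * (n / 3 + 1)))
mainTheorem5 (suc (suc m')) (suc (suc n')) (s≤s (s≤s z≤n)) (s≤s (s≤s z≤n)) m%3≡2 =
  (λ n≡3k₂ → atBound (upperBound₀ p q k k₂ m≡3k+2 (trans n≡3k₂ (*-comm 3 k₂)))) ,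
  (λ n≡3k₂+1 k≤2k₂ → atBound (upperBound₁ p q k k₂ (s≤s z≤n) m≡3k+2 (residue-form k₂ 1 n≡3k₂+1) k≤2k₂)) ,
  (λ n≡3k₂+1 2k₂<k g γ≡g → subst (_< g) (sym (cong (suc q *_) (+-comm k 1)))
     (strictBound₁ p q k k₂ m≡3k+2 (residue-form k₂ 1 n≡3k₂+1) 2k₂<k g γ≡g)) ,
  (λ n≡3k₂+2 m≤n → atBound (upperBound₂ p q k k₂ m≡3k+2 (residue-form k₂ 2 n≡3k₂+2)
     (quotient-mono m≡3k+2 (residue-form k₂ 2 n≡3k₂+2) m≤n))) ,
  (λ n≡3k₂+2 n≤m → subst (IsDomNumber (Torus p q)) (cong (suc p *_) (+-comm 1 k₂))
     (swap-domNumber {DirCycle (suc q)} {DirCycle (suc p)} (suc p * suc k₂)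
       (upperBound₂ q p k₂ k (residue-form k₂ 2 n≡3k₂+2) m≡3k+2 (quotient-mono (residue-form k₂ 2 n≡3k₂+2) m≡3k+2 n≤m))))
  where
  p = suc m'
  q = suc n'
  k = suc p / 3
  k₂ = suc q / 3
  m≡3k+2 : suc p ≡ 2 + k * 3
  m≡3k+2 = trans (m≡m%n+[m/n]*n (suc p) 3) (cong (_+ k * 3) m%3≡2)
  atBound : IsDomNumber (Torus p q) (suc q * suc k) → IsDomNumber (Torus p q) (suc q * (k + 1))
  atBound = subst (IsDomNumber (Torus p q)) (cong (suc q *_) (+-comm 1 k))
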